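{- For $n\ge1$, the number of Bell permutations of the second kind in $\mathfrak{S}_n$ having exactly $n-1$ weak exceedances equals the number of set partitions of $[n]$ with $n-1$ blocks, namely $\binom{n}{2}=\frac{n(n-1)}{2}$.
   Context: $\mathfrak{S}_n$ is the symmetric group on $[n]$. A weak exceedance of $\sigma$ is a position $i$ with $\sigma(i)\ge i$. For $\sigma\in\mathfrak{S}_n$ and $i\in[n]$, $\mathrm{inom}(i)=\sigma^{ -t}(i)$ where $t\ge1$ is smallest with $\sigma^{ -t}(i)\le i$; the inom code of $\sigma$ is $f_1\cdots f_n$ with $f_i=\mathrm{inom}(i)$ (equivalently the unique subexceedant function with $\sigma=(n\ f_n)\cdots(1\ f_1)$, leftmost transposition acting first). $\sigma$ is a Bell permutation of the second kind if its inom code has $\{f_1,\dots,f_i\}$ an integer interval for every $i\in[n]$. -}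

module Defs where

open import Data.Nat using (ℕ; zero; suc; _≤_; _<_; _≤?_)
open import Data.Fin using (Fin; toℕ)
open import Data.Vec using (Vec; lookup)
open import Data.List using (List; length; filter; allFin)
open import Data.Product using (Σ; _×_; ∃; ∃-syntax)
open import Relation.Binary.PropositionalEquality using (_≡_)

-- A candidate permutation of [n] is stored in one-line notation as a vector
-- σ = (σ(1), …, σ(n)) of elements of Fin n (0-based: value i stands for i+1).
-- σ(i) = lookup σ i.

-- σ is a permutation of [n] (injective, hence bijective on a finite set)
IsPerm : ∀ {n} → Vec (Fin n) n → Set
IsPerm {n} σ = ∀ (i j : Fin n) → lookup σ i ≡ lookup σ j → i ≡ j

iter : ∀ {n} → Vec (Fin n) n → ℕ → Fin n → Fin n
iter σ zero j = j
iter σ (suc t) j = lookup σ (iter σ t j)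

wex : ∀ {n} → Vec (Fin n) n → ℕ
wex {n} σ = length (filter (λ i → toℕ i ≤? toℕ (lookup σ i)) (allFin n))

-- IsInom σ i j  :⇔  inom(i) = j, i.e. j = σ^{-t}(i) for the smallest t ≥ 1
-- with σ^{-t}(i) ≤ i.  Written forwards: σ^t(j) = i, j ≤ i, and the
-- intermediate values σ^{-s}(i) = σ^{t-s}(j) (1 ≤ s < t) are all > i.
IsInom : ∀ {n} → Vec (Fin n) n → Fin n → Fin n → Set
IsInom σ i j =
  Σ ℕ λ t → (1 ≤ t) × (iter σ t j ≡ i) × (toℕ j ≤ toℕ i)
          × (∀ u → 1 ≤ u → u < t → toℕ i < toℕ (iter σ u j))

-- x ∈ {f_1, …, f_k}  (k given as the 0-based index of the last position)
InPrefix : ∀ {n} → (Fin n → Fin n) → Fin n → Fin n → Set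
InPrefix f k x = ∃[ j ] (toℕ j ≤ toℕ k × f j ≡ x)

PrefixIntervals : ∀ {n} → (Fin n → Fin n) → Set
PrefixIntervals {n} f =
  ∀ (k x y z : Fin n) → InPrefix f k x → InPrefix f k z →
    toℕ x ≤ toℕ y → toℕ y ≤ toℕ z → InPrefix f k y

IsBell2 : ∀ {n} → Vec (Fin n) n → Set
IsBell2 {n} σ =
  IsPerm σ × (Σ (Fin n → Fin n) λ f → (∀ i → IsInom σ i (f i)) × PrefixIntervals f)

S₂ : ℕ → ℕ → ℕ
S₂ zero zero = 1
S₂ zero (suc k) = 0
S₂ (suc n) zero = 0
S₂ (suc n) (suc k) = suc k Data.Nat.* S₂ n (suc k) Data.Nat.+ S₂ n k

-- Having n − 1 weak exceedances means having a single drop d.  Put m = σ(d) and b = σ(m) > m.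
-- The inom code inverts σ away from m, because an inom path of length ≥ 2 ends with a drop.
-- As f(i) ≤ i, induction shows that σ fixes every x < b other than m, and that f(i) = i − 1
-- for i > b: otherwise either f(i) ≥ i, so that the prefix {f₁, …, f_i} contains m = f(b)
-- and f(i) but not i − 1, or f(i) < i − 1 and then σ(f(i)) < i.  Hence σ is the cycle
-- (m b b+1 ⋯ n).  Conversely, every cycle (a b b+1 ⋯ n) with a < b has one drop and an inom
-- code (i below b, a at b, i − 1 above b) whose prefixes are initial segments, so these
-- permutations are in bijection with the C(n,2) = S(n, n − 1) pairs a < b.
module Submission where

open import Defs
open import Data.Nat using (ℕ; zero; suc; pred; _+_; _*_; _∸_; _≤_; _<_; z≤n; s≤s; NonZero; >-nonZero)
open import Data.Nat.Properties hiding (_≟_)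
open import Data.Nat.Combinatorics using (_C_; nC1≡n; nCk+nC[k+1]≡[n+1]C[k+1])
open import Data.Fin as Fin using (Fin; toℕ; fromℕ; fromℕ<)
open import Data.Fin.Properties using (toℕ-injective; toℕ-fromℕ; toℕ-fromℕ<; toℕ-inject₁; toℕ≤pred[n]; _≟_)
open import Data.Fin.Induction using (<-wellFounded)
open import Data.Vec using (Vec; lookup; tabulate)
open import Data.Vec.Properties using (lookup∘tabulate; tabulate∘lookup; tabulate-cong)
open import Data.List using (List; []; _∷_; length; filter; allFin; map; _++_)
open import Data.List.Properties using (length-tabulate; length-map; length-++)
open import Data.List.Membership.Propositional using (_∈_)
open import Data.List.Membership.Propositional.Properties
  using (∈-allFin; ∈-map⁺; ∈-map⁻; ∈-++⁺ˡ; ∈-++⁺ʳ; ∈-++⁻; ∈-filter⁺; ∈-filter⁻)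
open import Data.List.Relation.Unary.Any using (here; there)
import Data.List.Relation.Unary.All as All
import Data.List.Relation.Unary.All.Properties as All
open import Data.List.Relation.Unary.AllPairs using ([]; _∷_)
open import Data.List.Relation.Unary.Unique.Propositional using (Unique)
import Data.List.Relation.Unary.Unique.Propositional.Properties as Unique
open import Data.List.Relation.Ternary.Interleaving.Properties using (interleave-length)
import Data.List.Relation.Ternary.Interleaving.Setoid.Properties as Interleaving
open import Data.Product as Product using (Σ; _×_; _,_; proj₂; ∃-syntax; uncurry)
open import Data.Sum using (inj₁; inj₂)
open import Function using (_∘_; id)
open import Function.Bundles using (_⇔_; mk⇔)
open import Induction.WellFounded using (WfRec)
import Induction.WellFounded as WellFounded
open import Level using (0ℓ)
open import Relation.Binary.Definitions using (tri<; tri≈; tri>)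
open import Relation.Binary.PropositionalEquality
open import Relation.Nullary using (¬_; yes; no; contradiction)
open import Relation.Nullary.Decidable using (¬?)
open import Relation.Unary using (Decidable)

module _ {A : Set} where

  length≡1⇒singleton : {xs : List A} → length xs ≡ 1 →
    ∃[ x ] (x ∈ xs × ∀ {y} → y ∈ xs → y ≡ x)
  length≡1⇒singleton {x ∷ []} refl = x , here refl , λ { (here y≡x) → y≡x }

  singleton⇒length≡1 : {xs : List A} {x : A} → Unique xs → x ∈ xs →
    (∀ {y} → y ∈ xs → y ≡ x) → length xs ≡ 1
  singleton⇒length≡1 {y ∷ []} _ _ _ = refl
  singleton⇒length≡1 {y ∷ z ∷ _} ((y≢z All.∷ _) ∷ _) _ only =
    contradiction (trans (only (here refl)) (sym (only (there (here refl))))) y≢z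

  map⁺-injectiveOn : ∀ {B : Set} {f : A → B} {xs : List A} →
    (∀ {x y} → x ∈ xs → y ∈ xs → f x ≡ f y → x ≡ y) → Unique xs → Unique (map f xs)
  map⁺-injectiveOn {xs = []} _ [] = []
  map⁺-injectiveOn {xs = x ∷ xs} inj (x∉xs ∷ xs!) =
    All.map⁺ (All.tabulate λ y∈xs fx≡fy → All.lookup x∉xs y∈xs (inj (here refl) (there y∈xs) fx≡fy))
    ∷ map⁺-injectiveOn (λ x∈ y∈ → inj (there x∈) (there y∈)) xs!

module _ {n : ℕ} (σ : Vec (Fin n) n) where

  weakExceedance? : Decidable (λ i → toℕ i ≤ toℕ (lookup σ i))
  weakExceedance? i = toℕ i ≤? toℕ (lookup σ i)

  IsDrop : Fin n → Set
  IsDrop i = toℕ (lookup σ i) < toℕ i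

  drops : List (Fin n)
  drops = filter (¬? ∘ weakExceedance?) (allFin n)

  wex+drops : wex σ + length drops ≡ n
  wex+drops = trans
    (sym (interleave-length (Interleaving.filter⁺ (setoid (Fin n)) weakExceedance? (allFin n))))
    (length-tabulate id)

  ∈-drops⁺ : ∀ {i} → IsDrop i → i ∈ drops
  ∈-drops⁺ {i} drop = ∈-filter⁺ (¬? ∘ weakExceedance?) (∈-allFin i) (<⇒≱ drop)

  ∈-drops⁻ : ∀ {i} → i ∈ drops → IsDrop i
  ∈-drops⁻ i∈ = ≰⇒> (proj₂ (∈-filter⁻ (¬? ∘ weakExceedance?) {xs = allFin n} i∈))

module _ {k : ℕ} (σ : Vec (Fin (suc k)) (suc k)) where

  wex≡k⇒uniqueDrop : wex σ ≡ k → ∃[ d ] (IsDrop σ d × ∀ p → IsDrop σ p → p ≡ d)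
  wex≡k⇒uniqueDrop wex≡k with length≡1⇒singleton one-drop
    where
    one-drop : length (drops σ) ≡ 1
    one-drop = +-cancelˡ-≡ k _ 1
      (trans (cong (_+ length (drops σ)) (sym wex≡k)) (trans (wex+drops σ) (+-comm 1 k)))
  ... | d , d∈ , only = d , ∈-drops⁻ σ d∈ , λ p drop → only (∈-drops⁺ σ drop)

  uniqueDrop⇒wex≡k : ∀ {d} → IsDrop σ d → (∀ p → IsDrop σ p → p ≡ d) → wex σ ≡ k
  uniqueDrop⇒wex≡k {d} drop only = +-cancelʳ-≡ 1 (wex σ) k (trans wex+1 (+-comm 1 k))
    where
    one-drop : length (drops σ) ≡ 1
    one-drop = singleton⇒length≡1
      (Unique.filter⁺ (¬? ∘ weakExceedance? σ) (Unique.allFin⁺ (suc k)))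
      (∈-drops⁺ σ drop) (λ p∈ → only _ (∈-drops⁻ σ p∈))
    wex+1 : wex σ + 1 ≡ suc k
    wex+1 = trans (cong (wex σ +_) (sym one-drop)) (wex+drops σ)

IsInom-step : ∀ {n} {σ : Vec (Fin n) n} {i j : Fin n} →
  lookup σ j ≡ i → toℕ j ≤ toℕ i → IsInom σ i j
IsInom-step σj≡i j≤i = 1 , s≤s z≤n , σj≡i , j≤i , λ { (suc zero) _ (s≤s ()) }

IsInom⇒≤ : ∀ {n} {σ : Vec (Fin n) n} {i j : Fin n} → IsInom σ i j → toℕ j ≤ toℕ i
IsInom⇒≤ (_ , _ , _ , j≤i , _) = j≤i

downwardClosed⇒PrefixIntervals : ∀ {n} {f : Fin n → Fin n} →
  (∀ k {y z} → InPrefix f k z → toℕ y ≤ toℕ z → InPrefix f k y) → PrefixIntervals f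
downwardClosed⇒PrefixIntervals closed k x y z _ z∈ _ y≤z = closed k z∈ y≤z

toℕ-pred : ∀ {n} (i : Fin n) → toℕ (Fin.pred i) ≡ pred (toℕ i)
toℕ-pred Fin.zero = refl
toℕ-pred (Fin.suc i) = toℕ-inject₁ i

-- The cycle a → b → b+1 → ⋯ → k → a on 0-based points, fixing everything else.

module Cycle {k : ℕ} (a b : Fin (suc k)) where

  data Place (x : Fin (suc k)) : Set where
    source  : x ≡ a → Place x
    fixed   : x ≢ a → toℕ x < toℕ b → Place x
    shifted : x ≢ a → toℕ b ≤ toℕ x → toℕ x < k → Place x
    closing : x ≢ a → toℕ b ≤ toℕ x → toℕ x ≡ k → Place x

  place : ∀ x → Place x
  place x with x ≟ a | toℕ x <? toℕ b | toℕ x <? k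
  ... | yes x≡a | _ | _ = source x≡a
  ... | no x≢a | yes x<b | _ = fixed x≢a x<b
  ... | no x≢a | no x≮b | yes x<k = shifted x≢a (≮⇒≥ x≮b) x<k
  ... | no x≢a | no x≮b | no x≮k = closing x≢a (≮⇒≥ x≮b) (≤-antisym (toℕ≤pred[n] x) (≮⇒≥ x≮k))

  image : ∀ {x} → Place x → Fin (suc k)
  image (source _) = b
  image {x} (fixed _ _) = x
  image (shifted _ _ x<k) = fromℕ< (s≤s x<k)
  image (closing _ _ _) = a

  cycle : Fin (suc k) → Fin (suc k)
  cycle x = image (place x)

  cycleVec : Vec (Fin (suc k)) (suc k)
  cycleVec = tabulate cycle

  lookup-cycleVec : ∀ x → lookup cycleVec x ≡ cycle x
  lookup-cycleVec = lookup∘tabulate cycle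

  cycle-at : ∀ {x} (p : Place x) → cycle x ≡ image p
  cycle-at {x} p with place x
  cycle-at (source _)      | source _          = refl
  cycle-at (fixed _ _)     | fixed _ _         = refl
  cycle-at (shifted _ _ _) | shifted _ _ _     = refl
  cycle-at (closing _ _ _) | closing _ _ _     = refl
  cycle-at (source x≡a)    | fixed x≢a _       = contradiction x≡a x≢a
  cycle-at (source x≡a)    | shifted x≢a _ _   = contradiction x≡a x≢a
  cycle-at (source x≡a)    | closing x≢a _ _   = contradiction x≡a x≢a
  cycle-at (fixed x≢a _)   | source x≡a        = contradiction x≡a x≢a
  cycle-at (fixed _ x<b)   | shifted _ b≤x _   = contradiction b≤x (<⇒≱ x<b)
  cycle-at (fixed _ x<b)   | closing _ b≤x _   = contradiction b≤x (<⇒≱ x<b)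
  cycle-at (shifted x≢a _ _) | source x≡a      = contradiction x≡a x≢a
  cycle-at (shifted _ b≤x _) | fixed _ x<b     = contradiction b≤x (<⇒≱ x<b)
  cycle-at (shifted _ _ x<k) | closing _ _ x≡k = contradiction x≡k (<⇒≢ x<k)
  cycle-at (closing x≢a _ _) | source x≡a      = contradiction x≡a x≢a
  cycle-at (closing _ b≤x _) | fixed _ x<b     = contradiction b≤x (<⇒≱ x<b)
  cycle-at (closing _ _ x≡k) | shifted _ _ x<k = contradiction x≡k (<⇒≢ x<k)

  imageℕ : ∀ {x} → Place x → ℕ
  imageℕ (source _) = toℕ b
  imageℕ {x} (fixed _ _) = toℕ x
  imageℕ {x} (shifted _ _ _) = suc (toℕ x)
  imageℕ (closing _ _ _) = toℕ a

  toℕ-cycle : ∀ {x} (p : Place x) → toℕ (cycle x) ≡ imageℕ p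
  toℕ-cycle p@(source _) = cong toℕ (cycle-at p)
  toℕ-cycle p@(fixed _ _) = cong toℕ (cycle-at p)
  toℕ-cycle p@(shifted _ _ x<k) = trans (cong toℕ (cycle-at p)) (toℕ-fromℕ< (s≤s x<k))
  toℕ-cycle p@(closing _ _ _) = cong toℕ (cycle-at p)

  inomCode : Fin (suc k) → Fin (suc k)
  inomCode i with <-cmp (toℕ i) (toℕ b)
  ... | tri< _ _ _ = i
  ... | tri≈ _ _ _ = a
  ... | tri> _ _ _ = Fin.pred i

  inomCode-below : ∀ {i} → toℕ i < toℕ b → inomCode i ≡ i
  inomCode-below {i} i<b with <-cmp (toℕ i) (toℕ b)
  ... | tri< _ _ _ = refl
  ... | tri≈ i≮b _ _ = contradiction i<b i≮b
  ... | tri> i≮b _ _ = contradiction i<b i≮b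

  toℕ-inomCode-above : ∀ {i} → toℕ b < toℕ i → toℕ (inomCode i) ≡ pred (toℕ i)
  toℕ-inomCode-above {i} b<i with <-cmp (toℕ i) (toℕ b)
  ... | tri< _ _ i≯b = contradiction b<i i≯b
  ... | tri≈ _ _ i≯b = contradiction b<i i≯b
  ... | tri> _ _ _ = toℕ-pred i

  module _ (a<b : toℕ a < toℕ b) where

    a<k : toℕ a < k
    a<k = <-≤-trans a<b (toℕ≤pred[n] b)

    imageℕ-injective : ∀ {x y} (p : Place x) (q : Place y) → imageℕ p ≡ imageℕ q → x ≡ y
    imageℕ-injective (source x≡a)      (source y≡a)      _  = trans x≡a (sym y≡a)
    imageℕ-injective (source _)        (fixed _ y<b)     eq = contradiction eq (>⇒≢ y<b)
    imageℕ-injective (source _)        (shifted _ b≤y _) eq = contradiction eq (<⇒≢ (s≤s b≤y))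
    imageℕ-injective (source _)        (closing _ _ _)   eq = contradiction eq (>⇒≢ a<b)
    imageℕ-injective (fixed _ x<b)     (source _)        eq = contradiction eq (<⇒≢ x<b)
    imageℕ-injective (fixed _ _)       (fixed _ _)       eq = toℕ-injective eq
    imageℕ-injective (fixed _ x<b)     (shifted _ b≤y _) eq = contradiction eq (<⇒≢ (<-≤-trans x<b (m≤n⇒m≤1+n b≤y)))
    imageℕ-injective (fixed x≢a _)     (closing _ _ _)   eq = contradiction (toℕ-injective eq) x≢a
    imageℕ-injective (shifted _ b≤x _) (source _)        eq = contradiction eq (>⇒≢ (s≤s b≤x))
    imageℕ-injective (shifted _ b≤x _) (fixed _ y<b)     eq = contradiction eq (>⇒≢ (<-≤-trans y<b (m≤n⇒m≤1+n b≤x)))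
    imageℕ-injective (shifted _ _ _)   (shifted _ _ _)   eq = toℕ-injective (suc-injective eq)
    imageℕ-injective (shifted _ b≤x _) (closing _ _ _)   eq = contradiction eq (>⇒≢ (<-≤-trans a<b (m≤n⇒m≤1+n b≤x)))
    imageℕ-injective (closing _ _ _)   (source _)        eq = contradiction eq (<⇒≢ a<b)
    imageℕ-injective (closing _ _ _)   (fixed y≢a _)     eq = contradiction (toℕ-injective (sym eq)) y≢a
    imageℕ-injective (closing _ _ _)   (shifted _ b≤y _) eq = contradiction eq (<⇒≢ (<-≤-trans a<b (m≤n⇒m≤1+n b≤y)))
    imageℕ-injective (closing _ _ x≡k) (closing _ _ y≡k) _  = toℕ-injective (trans x≡k (sym y≡k))

    cycle-injective : ∀ x y → cycle x ≡ cycle y → x ≡ y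
    cycle-injective x y eq = imageℕ-injective (place x) (place y)
      (trans (sym (toℕ-cycle (place x))) (trans (cong toℕ eq) (toℕ-cycle (place y))))

    last-closing : Place (fromℕ k)
    last-closing = closing last≢a (subst (toℕ b ≤_) (sym (toℕ-fromℕ k)) (toℕ≤pred[n] b)) (toℕ-fromℕ k)
      where
      last≢a : fromℕ k ≢ a
      last≢a last≡a = <⇒≢ a<k (trans (cong toℕ (sym last≡a)) (toℕ-fromℕ k))

    cycle-drop⇒last : ∀ x → toℕ (cycle x) < toℕ x → x ≡ fromℕ k
    cycle-drop⇒last x drop with place x
    ... | source x≡a = contradiction (subst (λ y → toℕ b < toℕ y) x≡a drop) (<-asym a<b)
    ... | fixed _ _ = contradiction drop (<-irrefl refl)
    ... | shifted _ _ x<k = contradiction (subst (_< toℕ x) (toℕ-fromℕ< (s≤s x<k)) drop) (<⇒≱ (n<1+n _) ∘ <⇒≤)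
    ... | closing _ _ x≡k = toℕ-injective (trans x≡k (sym (toℕ-fromℕ k)))

    cycle-last : cycle (fromℕ k) ≡ a
    cycle-last = cycle-at last-closing

    wex-cycle : wex cycleVec ≡ k
    wex-cycle = uniqueDrop⇒wex≡k cycleVec last-drop only-last
      where
      last-drop : IsDrop cycleVec (fromℕ k)
      last-drop = subst₂ _<_ (cong toℕ (sym (trans (lookup-cycleVec (fromℕ k)) cycle-last))) (sym (toℕ-fromℕ k)) a<k
      only-last : ∀ x → IsDrop cycleVec x → x ≡ fromℕ k
      only-last x drop = cycle-drop⇒last x (subst (λ y → toℕ y < toℕ x) (lookup-cycleVec x) drop)

    iter-from-a : ∀ u → toℕ b + u ≤ k → toℕ (iter cycleVec (suc u) a) ≡ toℕ b + u
    iter-from-a zero _ = trans (cong toℕ (lookup-cycleVec a)) (trans (toℕ-cycle (source refl)) (sym (+-identityʳ _)))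
    iter-from-a (suc u) b+u<k =
      trans (cong toℕ (lookup-cycleVec x)) (trans (toℕ-cycle (shifted x≢a b≤x x<k)) (trans (cong suc ih) (sym (+-suc _ u))))
      where
      x = iter cycleVec (suc u) a
      ih : toℕ x ≡ toℕ b + u
      ih = iter-from-a u (≤-trans (n≤1+n _) (subst (_≤ k) (+-suc _ u) b+u<k))
      b≤x : toℕ b ≤ toℕ x
      b≤x = subst (toℕ b ≤_) (sym ih) (m≤m+n _ u)
      x≢a : x ≢ a
      x≢a x≡a = <-irrefl refl (<-≤-trans a<b (subst (λ y → toℕ b ≤ toℕ y) x≡a b≤x))
      x<k : toℕ x < k
      x<k = subst (_< k) (sym ih) (subst (_≤ k) (+-suc _ u) b+u<k)

    inom-a : IsInom cycleVec a a
    inom-a = suc (suc u₀) , s≤s z≤n , closes , ≤-refl , beyond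
      where
      u₀ = k ∸ toℕ b
      b+u₀≡k : toℕ b + u₀ ≡ k
      b+u₀≡k = m+[n∸m]≡n (toℕ≤pred[n] b)
      closes : lookup cycleVec (iter cycleVec (suc u₀) a) ≡ a
      closes = trans (lookup-cycleVec (iter cycleVec (suc u₀) a)) (trans (cong cycle reaches-last) cycle-last)
        where
        reaches-last : iter cycleVec (suc u₀) a ≡ fromℕ k
        reaches-last = toℕ-injective
          (trans (iter-from-a u₀ (≤-reflexive b+u₀≡k)) (trans b+u₀≡k (sym (toℕ-fromℕ k))))
      beyond : ∀ u → 1 ≤ u → u < suc (suc u₀) → toℕ a < toℕ (iter cycleVec u a)
      beyond (suc u) _ (s≤s (s≤s u≤u₀)) =
        subst (toℕ a <_) (sym (iter-from-a u (≤-trans (+-monoʳ-≤ (toℕ b) u≤u₀) (≤-reflexive b+u₀≡k))))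
              (<-≤-trans a<b (m≤m+n _ u))

    cycle-pred : ∀ {i} → toℕ b < toℕ i → cycle (Fin.pred i) ≡ i
    cycle-pred {i} b<i = trans (cycle-at (shifted j≢a b≤j j<k)) (toℕ-injective (trans (toℕ-fromℕ< (s≤s j<k)) suc-j≡i))
      where
      j = Fin.pred i
      suc-j≡i : suc (toℕ j) ≡ toℕ i
      suc-j≡i = trans (cong suc (toℕ-pred i)) (suc-pred (toℕ i) {{>-nonZero (m<n⇒0<n b<i)}})
      b≤j : toℕ b ≤ toℕ j
      b≤j = subst (toℕ b ≤_) (sym (toℕ-pred i)) (<⇒≤pred b<i)
      j≢a : j ≢ a
      j≢a j≡a = <-irrefl refl (<-≤-trans a<b (subst (λ y → toℕ b ≤ toℕ y) j≡a b≤j))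
      j<k : toℕ j < k
      j<k = subst (_≤ k) (sym suc-j≡i) (toℕ≤pred[n] i)

    inom-cycle : ∀ i → IsInom cycleVec i (inomCode i)
    inom-cycle i with <-cmp (toℕ i) (toℕ b)
    ... | tri< i<b _ _ with i ≟ a
    ...   | yes refl = inom-a
    ...   | no i≢a = IsInom-step (trans (lookup-cycleVec i) (cycle-at (fixed i≢a i<b))) ≤-refl
    inom-cycle i | tri≈ _ i≡b _ =
      IsInom-step (trans (lookup-cycleVec a) (trans (cycle-at (source refl)) (toℕ-injective (sym i≡b))))
                  (<⇒≤ (subst (toℕ a <_) (sym i≡b) a<b))
    inom-cycle i | tri> _ _ b<i =
      IsInom-step (trans (lookup-cycleVec (Fin.pred i)) (cycle-pred b<i)) (subst (_≤ toℕ i) (sym (toℕ-pred i)) pred[n]≤n)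

    b≤inomCode⇒b<i : ∀ {i} → toℕ b ≤ toℕ (inomCode i) → toℕ b < toℕ i
    b≤inomCode⇒b<i {i} b≤code with <-cmp (toℕ i) (toℕ b)
    ... | tri< i<b _ _ = contradiction b≤code (<⇒≱ i<b)
    ... | tri≈ _ _ _ = contradiction b≤code (<⇒≱ a<b)
    ... | tri> _ _ b<i = b<i

    inomCode-downwardClosed : ∀ p {y z} → InPrefix inomCode p z → toℕ y ≤ toℕ z → InPrefix inomCode p y
    inomCode-downwardClosed p {y} (j , j≤p , refl) y≤code with toℕ y <? toℕ b
    ... | yes y<b = y , ≤-trans y≤code (≤-trans (IsInom⇒≤ (inom-cycle j)) j≤p) , inomCode-below y<b
    ... | no y≮b = y⁺ , subst (_≤ toℕ p) (sym y⁺≡) (≤-trans y<j j≤p) , code-y⁺≡y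
      where
      b≤y = ≮⇒≥ y≮b
      b<j : toℕ b < toℕ j
      b<j = b≤inomCode⇒b<i (≤-trans b≤y y≤code)
      y<j : toℕ y < toℕ j
      y<j = ≤-<-trans (subst (toℕ y ≤_) (toℕ-inomCode-above b<j) y≤code)
                      (subst (pred (toℕ j) <_) (suc-pred (toℕ j) {{>-nonZero (m<n⇒0<n b<j)}}) (n<1+n _))
      y<k : toℕ y < k
      y<k = <-≤-trans y<j (toℕ≤pred[n] j)
      y⁺ = fromℕ< (s≤s y<k)
      y⁺≡ : toℕ y⁺ ≡ suc (toℕ y)
      y⁺≡ = toℕ-fromℕ< (s≤s y<k)
      code-y⁺≡y : inomCode y⁺ ≡ y
      code-y⁺≡y = toℕ-injective (trans (toℕ-inomCode-above (subst (toℕ b <_) (sym y⁺≡) (s≤s b≤y))) (cong pred y⁺≡))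

    cycle-isBell2 : IsBell2 cycleVec
    cycle-isBell2 = injective , inomCode , inom-cycle , downwardClosed⇒PrefixIntervals inomCode-downwardClosed
      where
      injective : IsPerm cycleVec
      injective i j eq = cycle-injective i j (trans (sym (lookup-cycleVec i)) (trans eq (lookup-cycleVec j)))

module OneDropBell {k : ℕ} (σ : Vec (Fin (suc k)) (suc k)) (σ-injective : IsPerm σ)
  (f : Fin (suc k) → Fin (suc k)) (f-inom : ∀ i → IsInom σ i (f i)) (f-intervals : PrefixIntervals f)
  (d : Fin (suc k)) (d-drop : IsDrop σ d) (drop⇒d : ∀ p → IsDrop σ p → p ≡ d) where

  σ⟨_⟩ : Fin (suc k) → Fin (suc k)
  σ⟨ x ⟩ = lookup σ x

  m b : Fin (suc k)
  m = σ⟨ d ⟩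
  b = σ⟨ m ⟩

  open Cycle m b using (Place; place; source; fixed; shifted; closing; cycle; cycleVec)

  m≢d : m ≢ d
  m≢d m≡d = <-irrefl (cong toℕ m≡d) d-drop

  m<b : toℕ m < toℕ b
  m<b = ≤∧≢⇒< (≮⇒≥ (m≢d ∘ drop⇒d m)) (λ m≡b → m≢d (σ-injective m d (toℕ-injective (sym m≡b))))

  b≢m : b ≢ m
  b≢m b≡m = <-irrefl (cong toℕ (sym b≡m)) m<b

  -- An inom path i = σᵗ(f i) with t ≥ 2 enters i from above, i.e. by the drop d, so i = m.
  σ∘f : ∀ i → i ≢ m → σ⟨ f i ⟩ ≡ i
  σ∘f i i≢m with f-inom i
  ... | suc zero , _ , σfi≡i , _ = σfi≡i
  ... | suc (suc t) , _ , reaches , _ , beyond = contradiction i≡m i≢m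
    where
    p = iter σ (suc t) (f i)
    i≡m : i ≡ m
    i≡m = trans (sym reaches)
      (cong σ⟨_⟩ (drop⇒d p (subst (λ y → toℕ y < toℕ p) (sym reaches) (beyond (suc t) (s≤s z≤n) ≤-refl))))

  f-inverts : ∀ {x i} → σ⟨ x ⟩ ≡ i → i ≢ m → f i ≡ x
  f-inverts {x} {i} σx≡i i≢m = σ-injective (f i) x (trans (σ∘f i i≢m) (sym σx≡i))

  f≤ : ∀ i → toℕ (f i) ≤ toℕ i
  f≤ i = IsInom⇒≤ (f-inom i)

  fixed-below-b : ∀ x → x ≢ m → toℕ x < toℕ b → σ⟨ x ⟩ ≡ x
  fixed-below-b = WellFounded.All.wfRec <-wellFounded 0ℓ Fixed step
    where
    Fixed : Fin (suc k) → Set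
    Fixed x = x ≢ m → toℕ x < toℕ b → σ⟨ x ⟩ ≡ x
    step : ∀ x → WfRec Fin._<_ Fixed x → Fixed x
    step x ih x≢m x<b with m≤n⇒m<n∨m≡n (f≤ x)
    ... | inj₂ fx≡x = subst (λ y → σ⟨ y ⟩ ≡ x) (toℕ-injective fx≡x) (σ∘f x x≢m)
    ... | inj₁ fx<x = contradiction (trans (sym (ih fx<x fx≢m (<-trans fx<x x<b))) (σ∘f x x≢m)) (<⇒≢ fx<x ∘ cong toℕ)
      where
      fx≢m : f x ≢ m
      fx≢m fx≡m = <-irrefl (cong toℕ (trans (sym (σ∘f x x≢m)) (cong σ⟨_⟩ fx≡m))) x<b

  f-below-b : ∀ j → toℕ j ≤ toℕ b → toℕ (f j) < toℕ b
  f-below-b j j≤b with j ≟ m | m≤n⇒m<n∨m≡n j≤b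
  ... | yes refl | _ = ≤-<-trans (f≤ m) m<b
  ... | no j≢m | inj₁ j<b = subst (λ y → toℕ y < toℕ b) (sym (f-inverts (fixed-below-b j j≢m j<b) j≢m)) j<b
  ... | no _ | inj₂ j≡b =
        subst (λ y → toℕ y < toℕ b) (sym (trans (cong f (toℕ-injective j≡b)) (f-inverts refl b≢m))) m<b

  above-b⇒≢m : ∀ {y} → toℕ b < toℕ y → y ≢ m
  above-b⇒≢m b<y y≡m = <-asym m<b (subst (λ w → toℕ b < toℕ w) y≡m b<y)

  CodeAbove : Fin (suc k) → Set
  CodeAbove i = toℕ b < toℕ i → toℕ (f i) ≡ pred (toℕ i)

  σ-succ : ∀ {x} (x<k : toℕ x < k) → toℕ b ≤ toℕ x → CodeAbove (fromℕ< (s≤s x<k)) → σ⟨ x ⟩ ≡ fromℕ< (s≤s x<k)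
  σ-succ {x} x<k b≤x code-x⁺ = subst (λ y → σ⟨ y ⟩ ≡ x⁺) f-x⁺≡x (σ∘f x⁺ (above-b⇒≢m b<x⁺))
    where
    x⁺ = fromℕ< (s≤s x<k)
    b<x⁺ : toℕ b < toℕ x⁺
    b<x⁺ = subst (toℕ b <_) (sym (toℕ-fromℕ< (s≤s x<k))) (s≤s b≤x)
    f-x⁺≡x : f x⁺ ≡ x
    f-x⁺≡x = toℕ-injective (trans (code-x⁺ b<x⁺) (cong pred (toℕ-fromℕ< (s≤s x<k))))

  module _ {i} (b<i : toℕ b < toℕ i) (ih : WfRec Fin._<_ CodeAbove i) where

    private instance
      i≢0 : NonZero (toℕ i)
      i≢0 = >-nonZero (m<n⇒0<n b<i)

    b≤i-1 : toℕ b ≤ pred (toℕ i)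
    b≤i-1 = <⇒≤pred b<i

    i-1<i : pred (toℕ i) < toℕ i
    i-1<i = subst (pred (toℕ i) <_) (suc-pred (toℕ i)) (n<1+n _)

    f-earlier : ∀ j → toℕ j < toℕ i → toℕ (f j) < pred (toℕ i)
    f-earlier j j<i with toℕ b <? toℕ j
    ... | yes b<j = subst (_< pred (toℕ i)) (sym (ih j<i b<j)) (pred-mono-< {{>-nonZero (m<n⇒0<n b<j)}} j<i)
    ... | no b≮j = <-≤-trans (f-below-b j (≮⇒≥ b≮j)) b≤i-1

    i-1∉prefix : pred (toℕ i) < toℕ (f i) → ¬ InPrefix f i (Fin.pred i)
    i-1∉prefix i-1<fi (j , j≤i , fj≡i-1) with m≤n⇒m<n∨m≡n j≤i
    ... | inj₁ j<i = <-irrefl (trans (cong toℕ fj≡i-1) (toℕ-pred i)) (f-earlier j j<i)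
    ... | inj₂ j≡i = <-irrefl (sym (trans (cong (toℕ ∘ f) (toℕ-injective (sym j≡i))) (trans (cong toℕ fj≡i-1) (toℕ-pred i)))) i-1<fi

    -- The prefix {f₀, …, f_i} contains m = f(b) ≤ i − 1 and f(i), but not i − 1.
    f≤i-1 : toℕ (f i) ≤ pred (toℕ i)
    f≤i-1 = ≮⇒≥ λ i-1<fi → i-1∉prefix i-1<fi
      (f-intervals i m (Fin.pred i) (f i) (b , <⇒≤ b<i , f-inverts refl b≢m) (i , ≤-refl , refl)
         (subst (toℕ m ≤_) (sym (toℕ-pred i)) (<⇒≤ (<-≤-trans m<b b≤i-1)))
         (subst (_≤ toℕ (f i)) (sym (toℕ-pred i)) (<⇒≤ i-1<fi)))

    σ-earlier : ∀ y → toℕ y < pred (toℕ i) → toℕ σ⟨ y ⟩ < toℕ i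
    σ-earlier y y<i-1 with y ≟ m | toℕ y <? toℕ b
    ... | yes refl | _ = b<i
    ... | no y≢m | yes y<b = subst (λ w → toℕ w < toℕ i) (sym (fixed-below-b y y≢m y<b)) (<-trans y<i-1 i-1<i)
    ... | no _ | no y≮b = subst (λ w → toℕ w < toℕ i) (sym (σ-succ y<k (≮⇒≥ y≮b) (ih y⁺<i))) y⁺<i
      where
      y+1<i : suc (toℕ y) < toℕ i
      y+1<i = subst (suc (toℕ y) <_) (suc-pred (toℕ i)) (s≤s y<i-1)
      y<k : toℕ y < k
      y<k = <-≤-trans (<-trans (n<1+n _) y+1<i) (toℕ≤pred[n] i)
      y⁺<i : toℕ (fromℕ< (s≤s y<k)) < toℕ i
      y⁺<i = subst (_< toℕ i) (sym (toℕ-fromℕ< (s≤s y<k))) y+1<i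

    i-1≤f : pred (toℕ i) ≤ toℕ (f i)
    i-1≤f = ≮⇒≥ λ fi<i-1 → <-irrefl (cong toℕ (σ∘f i (above-b⇒≢m b<i))) (σ-earlier (f i) fi<i-1)

  f-above-b : ∀ i → CodeAbove i
  f-above-b = WellFounded.All.wfRec <-wellFounded 0ℓ CodeAbove
    λ i ih b<i → ≤-antisym (f≤i-1 b<i ih) (i-1≤f b<i ih)

  d≡k : toℕ d ≡ k
  d≡k with place d
  ... | source d≡m = contradiction (sym d≡m) m≢d
  ... | fixed d≢m d<b = contradiction (cong toℕ (fixed-below-b d d≢m d<b)) (<⇒≢ d-drop)
  ... | shifted _ b≤d d<k =
        contradiction (trans (cong toℕ (σ-succ d<k b≤d (f-above-b _))) (toℕ-fromℕ< (s≤s d<k))) (<⇒≢ (<-trans d-drop (n<1+n _)))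
  ... | closing _ _ d≡k = d≡k

  σ≗cycle : ∀ x → σ⟨ x ⟩ ≡ cycle x
  σ≗cycle x with place x
  ... | source refl = refl
  ... | fixed x≢m x<b = fixed-below-b x x≢m x<b
  ... | shifted _ b≤x x<k = σ-succ x<k b≤x (f-above-b _)
  ... | closing _ _ x≡k = cong σ⟨_⟩ (toℕ-injective (trans x≡k (sym d≡k)))

  σ≡cycle : σ ≡ cycleVec
  σ≡cycle = trans (sym (tabulate∘lookup σ)) (tabulate-cong σ≗cycle)

module _ {n : ℕ} where

  startAtZero : Fin n → Fin (suc n) × Fin (suc n)
  startAtZero b = Fin.zero , Fin.suc b

  shiftPair : Fin n × Fin n → Fin (suc n) × Fin (suc n)
  shiftPair = Product.map Fin.suc Fin.suc

increasingPairs : ∀ n → List (Fin n × Fin n)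
increasingPairs zero = []
increasingPairs (suc n) =
  map startAtZero (allFin n) ++ map shiftPair (increasingPairs n)

∈-increasingPairs⁻ : ∀ {n a b} → (a , b) ∈ increasingPairs n → toℕ a < toℕ b
∈-increasingPairs⁻ {suc n} ab∈ with ∈-++⁻ (map startAtZero (allFin n)) ab∈
... | inj₁ ab∈zeros with ∈-map⁻ startAtZero ab∈zeros
...   | _ , _ , refl = s≤s z≤n
∈-increasingPairs⁻ {suc n} ab∈ | inj₂ ab∈sucs with ∈-map⁻ shiftPair ab∈sucs
...   | _ , ab∈′ , refl = s≤s (∈-increasingPairs⁻ ab∈′)

∈-increasingPairs⁺ : ∀ {n a b} → toℕ a < toℕ b → (a , b) ∈ increasingPairs n
∈-increasingPairs⁺ {suc n} {Fin.zero} {Fin.suc b} _ = ∈-++⁺ˡ (∈-map⁺ startAtZero (∈-allFin b))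
∈-increasingPairs⁺ {suc n} {Fin.suc a} {Fin.suc b} (s≤s a<b) =
  ∈-++⁺ʳ _ (∈-map⁺ shiftPair (∈-increasingPairs⁺ a<b))

increasingPairs-unique : ∀ n → Unique (increasingPairs n)
increasingPairs-unique zero = []
increasingPairs-unique (suc n) =
  Unique.++⁺ (Unique.map⁺ (λ { refl → refl }) (Unique.allFin⁺ n))
             (Unique.map⁺ (λ { {_ , _} {_ , _} refl → refl }) (increasingPairs-unique n))
             disjoint
  where
  disjoint : ∀ {ab} → ¬ (ab ∈ map startAtZero (allFin n)
                         × ab ∈ map shiftPair (increasingPairs n))
  disjoint (∈zeros , ∈sucs) with ∈-map⁻ startAtZero ∈zeros | ∈-map⁻ shiftPair ∈sucs
  ... | _ , _ , refl | _ , _ , ()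

length-increasingPairs : ∀ n → length (increasingPairs n) ≡ n C 2
length-increasingPairs zero = refl
length-increasingPairs (suc n) = begin
  length (map startAtZero (allFin n) ++ map shiftPair (increasingPairs n))
    ≡⟨ length-++ (map startAtZero (allFin n)) ⟩
  length (map startAtZero (allFin n)) + length (map shiftPair (increasingPairs n))
    ≡⟨ cong₂ _+_ (trans (length-map _ (allFin n)) (length-tabulate id))
                 (trans (length-map _ (increasingPairs n)) (length-increasingPairs n)) ⟩
  n + n C 2
    ≡⟨ cong (_+ n C 2) (sym (nC1≡n n)) ⟩
  n C 1 + n C 2
    ≡⟨ nCk+nC[k+1]≡[n+1]C[k+1] n 1 ⟩
  suc n C 2 ∎
  where open ≡-Reasoning

n<k⇒S₂nk≡0 : ∀ {n k} → n < k → S₂ n k ≡ 0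
n<k⇒S₂nk≡0 {zero} {suc k} _ = refl
n<k⇒S₂nk≡0 {suc n} {suc k} (s≤s n<k) =
  cong₂ _+_ (trans (cong (suc k *_) (n<k⇒S₂nk≡0 (m<n⇒m<1+n n<k))) (*-zeroʳ (suc k))) (n<k⇒S₂nk≡0 n<k)

S₂nn≡1 : ∀ n → S₂ n n ≡ 1
S₂nn≡1 zero = refl
S₂nn≡1 (suc n) = cong₂ _+_ (trans (cong (suc n *_) (n<k⇒S₂nk≡0 (n<1+n n))) (*-zeroʳ (suc n))) (S₂nn≡1 n)

S₂[1+n]n≡[1+n]C2 : ∀ n → S₂ (suc n) n ≡ suc n C 2
S₂[1+n]n≡[1+n]C2 zero = refl
S₂[1+n]n≡[1+n]C2 (suc n) = begin
  suc n * S₂ (suc n) (suc n) + S₂ (suc n) n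
    ≡⟨ cong₂ _+_ (trans (cong (suc n *_) (S₂nn≡1 (suc n))) (*-identityʳ (suc n))) (S₂[1+n]n≡[1+n]C2 n) ⟩
  suc n + suc n C 2
    ≡⟨ cong (_+ suc n C 2) (sym (nC1≡n (suc n))) ⟩
  suc n C 1 + suc n C 2
    ≡⟨ nCk+nC[k+1]≡[n+1]C[k+1] (suc n) 1 ⟩
  suc (suc n) C 2 ∎
  where open ≡-Reasoning

cycles : ∀ k → List (Vec (Fin (suc k)) (suc k))
cycles k = map (uncurry Cycle.cycleVec) (increasingPairs (suc k))

module _ {k : ℕ} where

  cycleVec-injective : ∀ {a b a′ b′ : Fin (suc k)} → toℕ a < toℕ b → toℕ a′ < toℕ b′ →
    Cycle.cycleVec a b ≡ Cycle.cycleVec a′ b′ → (a , b) ≡ (a′ , b′)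
  cycleVec-injective {a} {b} {a′} {b′} a<b a′<b′ eq with a≡a′
    where
    at-last : ∀ {a b} → toℕ a < toℕ b → lookup (Cycle.cycleVec a b) (fromℕ k) ≡ a
    at-last {a} {b} a<b = trans (Cycle.lookup-cycleVec a b (fromℕ k)) (Cycle.cycle-last a b a<b)
    a≡a′ : a ≡ a′
    a≡a′ = trans (sym (at-last a<b)) (trans (cong (λ τ → lookup τ (fromℕ k)) eq) (at-last a′<b′))
  ... | refl = cong (a ,_) (trans (sym (at-a b)) (trans (cong (λ τ → lookup τ a) eq) (at-a b′)))
    where
    at-a : ∀ b → lookup (Cycle.cycleVec a b) a ≡ b
    at-a b = trans (Cycle.lookup-cycleVec a b a) (Cycle.cycle-at a b (Cycle.source refl))

  cycles-unique : Unique (cycles k)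
  cycles-unique = map⁺-injectiveOn
    (λ ab∈ ab′∈ → cycleVec-injective (∈-increasingPairs⁻ ab∈) (∈-increasingPairs⁻ ab′∈))
    (increasingPairs-unique (suc k))

  length-cycles : length (cycles k) ≡ suc k C 2
  length-cycles = trans (length-map _ (increasingPairs (suc k))) (length-increasingPairs (suc k))

  ∈-cycles⁻ : ∀ {σ} → σ ∈ cycles k → IsBell2 σ × wex σ ≡ k
  ∈-cycles⁻ σ∈ with ∈-map⁻ (uncurry Cycle.cycleVec) σ∈
  ... | (a , b) , ab∈ , refl = Cycle.cycle-isBell2 a b a<b , Cycle.wex-cycle a b a<b
    where
    a<b = ∈-increasingPairs⁻ ab∈

  ∈-cycles⁺ : ∀ {σ} → IsBell2 σ × wex σ ≡ k → σ ∈ cycles k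
  ∈-cycles⁺ {σ} ((σ-injective , f , f-inom , f-intervals) , wex≡k) with wex≡k⇒uniqueDrop σ wex≡k
  ... | d , d-drop , drop⇒d =
        subst (_∈ cycles k) (sym σ≡cycle) (∈-map⁺ (uncurry Cycle.cycleVec) (∈-increasingPairs⁺ m<b))
    where
    open OneDropBell σ σ-injective f f-inom f-intervals d d-drop drop⇒d

mainTheorem8 : (n : ℕ) → 1 ≤ n →
    Σ (List (Vec (Fin n) n)) λ L →
    Unique L
    × (∀ σ → (σ ∈ L) ⇔ (IsBell2 σ × wex σ ≡ n ∸ 1))
    × (length L ≡ S₂ n (n ∸ 1))
    × (length L ≡ n C 2)
mainTheorem8 (suc k) _ =
  cycles k , cycles-unique , (λ σ → mk⇔ ∈-cycles⁻ ∈-cycles⁺) ,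
  trans (length-cycles {k}) (sym (S₂[1+n]n≡[1+n]C2 k)) , length-cycles {k}
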